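{- For any connected graph $G$ such that $G^c$ is connected, $\operatorname{Sd}_s(G,G^c)\le \min\{\beta_s(G),\beta_s(G^c)\}$.
   Context: All graphs are finite, simple and undirected; $G^c$ denotes the complement of $G$ on the same vertex set. For a connected graph $H$, $d_H(x,y)$ is the length of a shortest $x$–$y$ path; a vertex $w$ strongly resolves $u,v$ if $d_H(u,w)=d_H(u,v)+d_H(v,w)$ or $d_H(v,w)=d_H(v,u)+d_H(u,w)$; a set $S\subseteq V(H)$ is a strong metric generator for $H$ if every two distinct vertices are strongly resolved by some vertex of $S$. For connected graphs $G_1,\dots,G_k$ on a common vertex set $V$, $\operatorname{Sd}_s(G_1,\dots,G_k)$ is the minimum cardinality of a set $S\subseteq V$ that is a strong metric generator for every $G_i$. A strong resolving cover for $H$ is a set that is both a vertex cover of $H$ (meets every edge) and a strong metric generator for $H$; $\beta_s(H)$ is the minimum cardinality of a strong resolving cover for $H$. -}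

module Defs where

open import Data.Nat using (ℕ; zero; suc; _+_; _≤_; _<_; _⊓_)
open import Data.Fin using (Fin)
open import Data.Fin.Subset using (Subset; _∈_; ∣_∣)
open import Data.Product using (Σ; ∃; _×_; _,_)
open import Data.Sum using (_⊎_)
open import Relation.Nullary using (¬_)
open import Relation.Binary.PropositionalEquality using (_≡_; _≢_; sym; refl)

record Graph (n : ℕ) : Set₁ where
  field
    Adj     : Fin n → Fin n → Set
    symAdj  : ∀ {x y} → Adj x y → Adj y x
    irrefl  : ∀ {x} → ¬ Adj x x
open Graph public

complement : ∀ {n} → Graph n → Graph n
complement G = record
  { Adj    = λ x y → ¬ Adj G x y × x ≢ y
  ; symAdj = λ { (na , neq) → (λ a → na (symAdj G a)) , (λ e → neq (sym e)) }
  ; irrefl = λ { (_ , neq) → neq refl }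
  }

data Walk {n : ℕ} (G : Graph n) : Fin n → Fin n → ℕ → Set where
  here : ∀ {x} → Walk G x x zero
  step : ∀ {x y z k} → Adj G x y → Walk G y z k → Walk G x z (suc k)

Connected : ∀ {n} → Graph n → Set
Connected G = ∀ x y → ∃ λ k → Walk G x y k

Dist : ∀ {n} → Graph n → Fin n → Fin n → ℕ → Set
Dist G x y k = Walk G x y k × (∀ m → m < k → ¬ Walk G x y m)

StronglyResolves : ∀ {n} → Graph n → Fin n → Fin n → Fin n → Set
StronglyResolves G w u v =
  (∃ λ a → ∃ λ b → ∃ λ c → Dist G u w a × Dist G u v b × Dist G v w c × a ≡ b + c)
  ⊎ (∃ λ a → ∃ λ b → ∃ λ c → Dist G v w a × Dist G v u b × Dist G u w c × a ≡ b + c)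

IsStrongMetricGenerator : ∀ {n} → Graph n → Subset n → Set
IsStrongMetricGenerator G S =
  ∀ u v → u ≢ v → ∃ λ w → w ∈ S × StronglyResolves G w u v

IsVertexCover : ∀ {n} → Graph n → Subset n → Set
IsVertexCover G S = ∀ x y → Adj G x y → x ∈ S ⊎ y ∈ S

IsStrongResolvingCover : ∀ {n} → Graph n → Subset n → Set
IsStrongResolvingCover G S = IsVertexCover G S × IsStrongMetricGenerator G S

IsMinCard : ∀ {n} → (Subset n → Set) → ℕ → Set
IsMinCard P k = (∃ λ S → P S × ∣ S ∣ ≡ k) × (∀ S → P S → k ≤ ∣ S ∣)

IsSimultaneousStrongMetricDim : ∀ {n} → Graph n → Graph n → ℕ → Set
IsSimultaneousStrongMetricDim G₁ G₂ =
  IsMinCard (λ S → IsStrongMetricGenerator G₁ S × IsStrongMetricGenerator G₂ S)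

IsStrongResolvingCoverNumber : ∀ {n} → Graph n → ℕ → Set
IsStrongResolvingCoverNumber G = IsMinCard (IsStrongResolvingCover G)

module Submission where

-- Let S be a strong resolving cover of G; we show S strongly resolves Gᶜ. If u or v lies in S it
-- resolves the pair itself. Otherwise u, v ∉ S, so uv is not an edge of G and u ~ v in Gᶜ. Take
-- w ∈ S with d(u,w) = d(u,v) + d(v,w) in G and let y be the successor of v on a shortest v–w
-- path. As S covers the edge vy, y ∈ S; y is not a G-neighbour of u, since the path through y
-- would be too short. Hence in Gᶜ the path v – u – y is geodesic, and y strongly resolves u, v.
-- Adjacency is an arbitrary proposition, so distances and complements are only available under
-- double negation; the conclusion is an inequality of naturals, hence stable.

open import Defs
open import Data.Nat using (ℕ; zero; suc; _≤_; _<_; _+_; _⊓_; s≤s; _≤?_)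
open import Data.Nat.Properties using (⊓-glb; m≤n+m; +-identityʳ)
open import Data.Nat.Induction using (<-rec)
open import Data.Fin using (_≟_)
open import Data.Fin.Properties using (sequence)
open import Data.Fin.Subset using (Subset; _∈_; _∉_)
open import Data.Fin.Subset.Properties using (_∈?_)
open import Data.Product using (∃; _×_; _,_; proj₁; proj₂)
open import Data.Sum using (inj₁; inj₂)
open import Function using (const)
open import Relation.Nullary using (¬_; yes; no)
open import Relation.Nullary.Decidable using (decidable-stable)
open import Relation.Nullary.Negation using (¬¬-Monad; ¬¬-map; contradiction)
open import Relation.Binary.PropositionalEquality using (_≡_; _≢_; refl; sym; subst; ≢-sym)
open import Effect.Monad using (RawMonad)
open import Level using (0ℓ)

open RawMonad (¬¬-Monad {a = 0ℓ}) using (_>>=_; pure; rawApplicative)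

private
  variable
    n : ℕ

¬¬-least : ∀ {P : ℕ → Set} {k} → P k → ¬ ¬ ∃ λ b → P b × (∀ m → m < b → ¬ P m)
¬¬-least {P} {k} pk noLeast =
  <-rec (λ j → ¬ P j) (λ j smaller pj → noLeast (j , pj , λ m m<j → smaller m<j)) k pk

walk-zero : ∀ {G : Graph n} {x y} → Walk G x y 0 → x ≡ y
walk-zero here = refl

connected⇒¬¬dist : ∀ {G : Graph n} → Connected G → ∀ x y → ¬ ¬ ∃ (Dist G x y)
connected⇒¬¬dist conn x y = ¬¬-least (proj₂ (conn x y))

dist-refl : ∀ {G : Graph n} {x} → Dist G x x 0
dist-refl = here , λ _ ()

dist-one : ∀ {G : Graph n} {x y} → x ≢ y → Adj G x y → Dist G x y 1
dist-one x≢y xy = step xy here , λ where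
  zero    _         w → x≢y (walk-zero w)
  (suc _) (s≤s ()) _

dist-two : ∀ {G : Graph n} {x y z} → Adj G x y → Adj G y z →
  ¬ Adj G x z → x ≢ z → Dist G x z 2
dist-two {G = G} {x} {z = z} xy yz ¬xz x≢z = step xy (step yz here) , shorter
  where
  shorter : ∀ m → m < 2 → ¬ Walk G x z m
  shorter zero          _               w          = x≢z (walk-zero w)
  shorter (suc zero)    _               (step xz w) with walk-zero w
  ... | refl = ¬xz xz
  shorter (suc (suc _)) (s≤s (s≤s ())) _

¬adj-shortcut : ∀ {G : Graph n} {u y w b c} → Dist G u w (suc b + suc c) →
  Walk G y w c → ¬ Adj G u y
¬adj-shortcut {b = b} {c} (_ , shortest) yw uy =
  shortest (suc c) (s≤s (m≤n+m (suc c) b)) (step uy yw)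

StronglyResolves-sym : ∀ {G : Graph n} {w u v} →
  StronglyResolves G w u v → StronglyResolves G w v u
StronglyResolves-sym (inj₁ r) = inj₂ r
StronglyResolves-sym (inj₂ r) = inj₁ r

dist⇒StronglyResolves-source : ∀ {G : Graph n} {u v b} →
  Dist G v u b → StronglyResolves G u u v
dist⇒StronglyResolves-source {b = b} d =
  inj₂ (b , b , 0 , d , d , dist-refl , sym (+-identityʳ b))

-- Symmetric in use: complement (complement G) is not definitionally G, so (Gᶜ, G) needs it too.
record Complementary (H K : Graph n) : Set where
  field
    nonadjacent⇒adjacent : ∀ {x y} → ¬ Adj H x y → x ≢ y → ¬ ¬ Adj K x y
    adjacent⇒nonadjacent : ∀ {x y} → Adj H x y → ¬ Adj K x y

complement-complementary : (G : Graph n) → Complementary G (complement G)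
complement-complementary G = record
  { nonadjacent⇒adjacent = λ ¬xy x≢y → pure (¬xy , x≢y)
  ; adjacent⇒nonadjacent = λ xy (¬xy , _) → ¬xy xy
  }

complementary-complement : (G : Graph n) → Complementary (complement G) G
complementary-complement G = record
  { nonadjacent⇒adjacent = λ ¬xy x≢y ¬adj → ¬xy (¬adj , x≢y)
  ; adjacent⇒nonadjacent = proj₁
  }

module _ {H K : Graph n} (H∁K : Complementary H K) {S : Subset n}
         (cover : IsVertexCover H S) where

  open Complementary H∁K

  ∈-∉⇒≢ : ∀ {x y} → x ∈ S → y ∉ S → x ≢ y
  ∈-∉⇒≢ x∈S y∉S refl = y∉S x∈S

  outside-nonadjacent : ∀ {u v} → u ∉ S → v ∉ S → ¬ Adj H u v
  outside-nonadjacent u∉S v∉S uv with cover _ _ uv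
  ... | inj₁ u∈S = u∉S u∈S
  ... | inj₂ v∈S = v∉S v∈S

  resolver-neighbour-resolves : ∀ {u v w a b c} → u ≢ v → u ∉ S → v ∉ S → w ∈ S →
    Dist H u w a → Dist H u v b → Dist H v w c → a ≡ b + c →
    ¬ ¬ ∃ λ y → y ∈ S × StronglyResolves K y u v
  resolver-neighbour-resolves u≢v u∉S v∉S w∈S _ _ (here , _) _ = contradiction w∈S v∉S
  resolver-neighbour-resolves {b = zero} u≢v _ _ _ _ (uv , _) _ _ =
    contradiction (walk-zero uv) u≢v
  resolver-neighbour-resolves {u} {v} {b = suc _} u≢v u∉S v∉S _
      uw _ (step {y = y} vy yw , _) refl
    with cover v y vy
  ... | inj₁ v∈S = contradiction v∈S v∉S
  ... | inj₂ y∈S = do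
    uy ← nonadjacent⇒adjacent (¬adj-shortcut uw yw) u≢y
    vu ← nonadjacent⇒adjacent (outside-nonadjacent v∉S u∉S) (≢-sym u≢v)
    pure (y , y∈S , inj₂ (2 , 1 , 1 ,
      dist-two vu uy (adjacent⇒nonadjacent vy) (λ { refl → irrefl H vy }) ,
      dist-one (≢-sym u≢v) vu , dist-one u≢y uy , refl))
    where
    u≢y : u ≢ y
    u≢y = ≢-sym (∈-∉⇒≢ y∈S u∉S)

  strongResolvingCover⇒¬¬StrongMetricGenerator : Connected K →
    IsStrongMetricGenerator H S → ¬ ¬ IsStrongMetricGenerator K S
  strongResolvingCover⇒¬¬StrongMetricGenerator connK generator =
    sequence rawApplicative λ u → sequence rawApplicative λ v → resolvedIfDistinct u v
    where
    resolved : ∀ u v → u ≢ v → ¬ ¬ ∃ λ y → y ∈ S × StronglyResolves K y u v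
    resolved u v u≢v with u ∈? S | v ∈? S
    ... | yes u∈S | _ = do
      (_ , vu) ← connected⇒¬¬dist connK v u
      pure (u , u∈S , dist⇒StronglyResolves-source vu)
    ... | no _ | yes v∈S = do
      (_ , uv) ← connected⇒¬¬dist connK u v
      pure (v , v∈S , StronglyResolves-sym (dist⇒StronglyResolves-source uv))
    ... | no u∉S | no v∉S with generator u v u≢v
    ... | w , w∈S , inj₁ (_ , _ , _ , uw , uv , vw , a≡b+c) =
      resolver-neighbour-resolves u≢v u∉S v∉S w∈S uw uv vw a≡b+c
    ... | w , w∈S , inj₂ (_ , _ , _ , vw , vu , uw , a≡b+c) = do
      (y , y∈S , r) ← resolver-neighbour-resolves (≢-sym u≢v) v∉S u∉S w∈S
                        vw vu uw a≡b+c
      pure (y , y∈S , StronglyResolves-sym r)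

    resolvedIfDistinct : ∀ u v →
      ¬ ¬ (u ≢ v → ∃ λ y → y ∈ S × StronglyResolves K y u v)
    resolvedIfDistinct u v with u ≟ v
    ... | yes u≡v = pure (contradiction u≡v)
    ... | no u≢v  = ¬¬-map const (resolved u v u≢v)

mainTheorem14 : ∀ {n} (G : Graph n) → Connected G → Connected (complement G) →
    ∀ (sd b bc : ℕ) →
    IsSimultaneousStrongMetricDim G (complement G) sd →
    IsStrongResolvingCoverNumber G b →
    IsStrongResolvingCoverNumber (complement G) bc →
    sd ≤ b ⊓ bc
mainTheorem14 G connG connGᶜ sd b bc (_ , sd-minimal)
  ((S , (coverS , generatorS) , ∣S∣≡b) , _) ((T , (coverT , generatorT) , ∣T∣≡bc) , _) =
  ⊓-glb (decidable-stable (sd ≤? b) sd≤b) (decidable-stable (sd ≤? bc) sd≤bc)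
  where
  sd≤b : ¬ ¬ sd ≤ b
  sd≤b = ¬¬-map
    (λ generatorᶜ → subst (sd ≤_) ∣S∣≡b (sd-minimal S (generatorS , generatorᶜ)))
    (strongResolvingCover⇒¬¬StrongMetricGenerator
      (complement-complementary G) coverS connGᶜ generatorS)

  sd≤bc : ¬ ¬ sd ≤ bc
  sd≤bc = ¬¬-map
    (λ generator → subst (sd ≤_) ∣T∣≡bc (sd-minimal T (generator , generatorT)))
    (strongResolvingCover⇒¬¬StrongMetricGenerator
      (complementary-complement G) coverT connG generatorT)
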